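{- Let $r\geq 2$ and $n\geq 2r+1$, and let $k$ be a positive integer with $k\geq 2$ if $r=2$ (and $k\geq 1$ otherwise). If $D$ is a $k$-tuple dominating set of $K(n,r)$ with $|D|=k+r$, then the vertices of $D$ are pairwise disjoint $r$-subsets of $[n]$.
   Context: The Kneser graph $K(n,r)$ has as vertices the $r$-subsets of $[n]=\{1,\dots,n\}$, two vertices adjacent iff disjoint. For a vertex $v$, $N[v]$ is its closed neighbourhood. A set $D$ of vertices is a $k$-tuple dominating set if $|N[v]\cap D|\geq k$ for every vertex $v$. -}

module Defs where

open import Data.Nat using (ℕ)
open import Data.Bool using () renaming (_≟_ to _≟ᵇ_)
open import Data.Fin.Subset using (Subset; _∩_; ⊥; ∣_∣)
open import Data.Vec.Properties using (≡-dec)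
open import Data.List using (List; length; filter)
open import Data.List.Relation.Unary.All using (All)
open import Data.List.Relation.Unary.Unique.Propositional using (Unique)
open import Data.List.Relation.Binary.Pointwise using ()
open import Data.Sum using (_⊎_)
open import Data.Product using (_×_)
open import Relation.Binary.PropositionalEquality using (_≡_)
open import Relation.Nullary using (Dec; ¬_)
import Data.List.Membership.Propositional
open import Relation.Nullary.Decidable using (_⊎-dec_)

-- Ground set [n] is Fin n; an r-subset is a Subset n with ∣ s ∣ ≡ r.
_≟ˢ_ : ∀ {n} (s t : Subset n) → Dec (s ≡ t)
_≟ˢ_ = ≡-dec _≟ᵇ_

Disjoint : ∀ {n} → Subset n → Subset n → Set
Disjoint s t = s ∩ t ≡ ⊥

disjoint? : ∀ {n} (s t : Subset n) → Dec (Disjoint s t)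
disjoint? s t = (s ∩ t) ≟ˢ ⊥

-- d ∈ N[v] in the Kneser graph: d = v or d adjacent to v (disjoint).
-- (For r ≥ 1 a vertex is never disjoint from itself, so no loops.)
InClosedNbhd : ∀ {n} → Subset n → Subset n → Set
InClosedNbhd v d = (d ≡ v) ⊎ Disjoint d v

inClosedNbhd? : ∀ {n} (v d : Subset n) → Dec (InClosedNbhd v d)
inClosedNbhd? v d = (d ≟ˢ v) ⊎-dec disjoint? d v

closedNbhdCount : ∀ {n} → Subset n → List (Subset n) → ℕ
closedNbhdCount v D = length (filter (inClosedNbhd? v) D)

IsVertexSet : (n r : ℕ) → List (Subset n) → Set
IsVertexSet n r D = Unique D × All (λ d → ∣ d ∣ ≡ r) D

IsKTupleDominating : (n r k : ℕ) → List (Subset n) → Set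
IsKTupleDominating n r k D =
  IsVertexSet n r D × (∀ (v : Subset n) → ∣ v ∣ ≡ r → k Data.Nat.≤ closedNbhdCount v D)

PairwiseDisjoint : ∀ {n} → List (Subset n) → Set
PairwiseDisjoint {n} D = ∀ (x y : Subset n) → x Data.List.Membership.Propositional.∈ D →
  y Data.List.Membership.Propositional.∈ D → ¬ (x ≡ y) → Disjoint x y

{-# OPTIONS --safe #-}
-- Since |N[v] ∩ D| ≥ k and |D| = k + r, at most r members of D other than v meet an r-set v: so at most
-- r + 1 members of D meet v, and at most r if v ∉ D.  Suppose two members of D share a point a.  Grow
-- T ∋ a to size r - 1 by repeatedly adding a point of a member of D disjoint from T, collecting members
-- of D that meet T.  If r + 1 of them meet T, every petal T ∪ {e} (e ∉ T) lies in D, and these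
-- n - r + 1 ≥ r + 2 sets pairwise share a: too many.  Otherwise a member d disjoint from T forces the
-- r petals T ∪ {e}, e ∈ d, into D, and with d and one more member missing a they are r + 2 members of D
-- meeting T ∪ {e₀}.  For r = 2 that extra member is a second set avoiding a, which exists as k ≥ 2.
module Submission where

open import Defs
open import Data.Nat using (ℕ; zero; suc; _+_; _*_; _∸_; _≤_; _<_; z≤n; s≤s; _≤?_)
open import Data.Nat.Properties
open import Data.Bool using (true; false)
open import Data.Fin using (Fin; zero; suc)
import Data.Fin.Properties as Fin
open import Data.Fin.Subset using (Subset; _∩_; _∪_; ⁅_⁆; ∣_∣; ∁; Nonempty)
  renaming (_∈_ to _∈ₛ_; _∉_ to _∉ₛ_)
open import Data.Fin.Subset.Properties
  using (x∈⁅x⁆; x∈⁅y⁆⇒x≡y; x∈p∩q⁺; x∈p∩q⁻; x∈p∪q⁺; x∈p∪q⁻; ∣⁅x⁆∣≡1; x∈∁p⇒x∉p;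
         ∣∁p∣≡n∸∣p∣; ∉⊥; ∣⊥∣≡0; nonempty?; Empty-unique; ∪-identityʳ)
  renaming (_∈?_ to _∈ₛ?_)
open import Data.Vec using ([]; _∷_; here; there)
open import Data.List using (List; []; _∷_; length; filter; map; _++_)
open import Data.List.Properties using (length-map; length-++; filter-notAll)
open import Data.List.Relation.Unary.All as All using (All; []; _∷_)
import Data.List.Relation.Unary.All.Properties as All
open import Data.List.Relation.Unary.Any as Any using (here; there; any?)
open import Data.List.Relation.Unary.AllPairs using ([]; _∷_)
open import Data.List.Relation.Unary.Unique.Propositional using (Unique)
import Data.List.Relation.Unary.Unique.Propositional.Properties as Unique
open import Data.List.Relation.Binary.Subset.Propositional using (_⊆_)
open import Data.List.Membership.Propositional using (_∈_; find)
open import Data.List.Membership.Propositional.Properties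
  using (∈-filter⁺; ∈-filter⁻; ∈-map⁻; ∈-++⁻)
import Data.List.Membership.DecPropositional as DecMembership
open import Data.Product using (∃-syntax; _×_; _,_; proj₁; proj₂)
open import Data.Sum using (_⊎_; inj₁; inj₂; [_,_])
open import Data.Empty using (⊥)
open import Function using (_∘_)
open import Relation.Binary.Definitions using (DecidableEquality)
open import Relation.Binary.PropositionalEquality using (_≡_; refl; sym; trans; cong; cong₂; subst)
open import Relation.Nullary using (¬_; yes; no; ¬?; contradiction)
open import Relation.Nullary.Decidable using (decidable-stable)
open import Relation.Unary using (Pred; Decidable)
open import Level using (0ℓ)

module _ {A : Set} where

  length-filter+filter-∁ : {P : Pred A 0ℓ} (P? : Decidable P) (xs : List A) →
    length (filter P? xs) + length (filter (¬? ∘ P?) xs) ≡ length xs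
  length-filter+filter-∁ P? [] = refl
  length-filter+filter-∁ P? (x ∷ xs) with P? x
  ... | yes _ = cong suc (length-filter+filter-∁ P? xs)
  ... | no _ = trans (+-suc _ _) (cong suc (length-filter+filter-∁ P? xs))

  Unique-⊆⇒length≤ : DecidableEquality A → {xs ys : List A} → Unique xs → xs ⊆ ys →
    length xs ≤ length ys
  Unique-⊆⇒length≤ _≟_ [] _ = z≤n
  Unique-⊆⇒length≤ _≟_ {x ∷ xs} {ys} (x∉xs ∷ xs-unique) xs⊆ys = begin-strict
    length xs                          ≤⟨ Unique-⊆⇒length≤ _≟_ xs-unique xs⊆ys-x ⟩
    length (filter (¬? ∘ (_≟ x)) ys)  <⟨ filter-notAll (¬? ∘ (_≟ x)) ys x∈ys ⟩
    length ys                          ∎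
    where
    open ≤-Reasoning
    xs⊆ys-x : xs ⊆ filter (¬? ∘ (_≟ x)) ys
    xs⊆ys-x y∈xs = ∈-filter⁺ _ (xs⊆ys (there y∈xs)) (λ y≡x → All.lookup x∉xs y∈xs (sym y≡x))
    x∈ys = Any.map (λ x≡y y≢x → y≢x (sym x≡y)) (xs⊆ys (here refl))

  Unique-map⁺ : {B : Set} (f : A → B) {xs : List A} →
    (∀ {x y} → x ∈ xs → y ∈ xs → f x ≡ f y → x ≡ y) → Unique xs → Unique (map f xs)
  Unique-map⁺ f {[]} _ [] = []
  Unique-map⁺ f {x ∷ xs} injective (x∉xs ∷ xs-unique) =
    All.map⁺ (All.tabulate (λ y∈xs fx≡fy → All.lookup x∉xs y∈xs (injective (here refl) (there y∈xs) fx≡fy)))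
    ∷ Unique-map⁺ f (λ p q → injective (there p) (there q)) xs-unique

  distinct-pair : {xs : List A} → 2 ≤ length xs → Unique xs →
    ∃[ x ] ∃[ y ] x ∈ xs × y ∈ xs × ¬ x ≡ y
  distinct-pair {_ ∷ []} (s≤s ()) _
  distinct-pair {x ∷ y ∷ _} _ ((x≢y ∷ _) ∷ _) = x , y , here refl , there (here refl) , x≢y

2≤m⇒≡2⊎≡3+ : ∀ {m} → 2 ≤ m → m ≡ 2 ⊎ ∃[ q ] m ≡ 3 + q
2≤m⇒≡2⊎≡3+ {suc zero} (s≤s ())
2≤m⇒≡2⊎≡3+ {suc (suc zero)} _ = inj₁ refl
2≤m⇒≡2⊎≡3+ {suc (suc (suc q))} _ = inj₂ (q , refl)

2+r≤n∸t : ∀ {t r n} → suc t ≡ r → suc (2 * r) ≤ n → suc (suc r) ≤ n ∸ t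
2+r≤n∸t {t} {n = n} refl 2r+1≤n = begin
  3 + t          ≡⟨ sym (m+n∸n≡m (3 + t) t) ⟩
  3 + t + t ∸ t  ≤⟨ ∸-monoˡ-≤ t (≤-trans (≤-reflexive 3+2t≡1+2[1+t]) 2r+1≤n) ⟩
  n ∸ t          ∎
  where
  open ≤-Reasoning
  3+2t≡1+2[1+t] : 3 + t + t ≡ suc (2 * suc t)
  3+2t≡1+2[1+t] = cong (2 +_) (sym (trans (+-suc t (t + 0)) (cong (λ m → suc (t + m)) (+-identityʳ t))))

elements : ∀ {n} → Subset n → List (Fin n)
elements {zero} [] = []
elements {suc _} (true ∷ p) = zero ∷ map suc (elements p)
elements {suc _} (false ∷ p) = map suc (elements p)

length-elements : ∀ {n} (p : Subset n) → length (elements p) ≡ ∣ p ∣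
length-elements {zero} [] = refl
length-elements {suc _} (true ∷ p) = cong suc (trans (length-map suc (elements p)) (length-elements p))
length-elements {suc _} (false ∷ p) = trans (length-map suc (elements p)) (length-elements p)

∈-elements⁻ : ∀ {n} (p : Subset n) {i : Fin n} → i ∈ elements p → i ∈ₛ p
∈-elements⁻ {suc _} (true ∷ p) (here refl) = here
∈-elements⁻ {suc _} (true ∷ p) (there i∈) with ∈-map⁻ suc i∈
... | _ , j∈ , refl = there (∈-elements⁻ p j∈)
∈-elements⁻ {suc _} (false ∷ p) i∈ with ∈-map⁻ suc i∈
... | _ , j∈ , refl = there (∈-elements⁻ p j∈)

elements-unique : ∀ {n} (p : Subset n) → Unique (elements p)
elements-unique {zero} [] = []
elements-unique {suc _} (true ∷ p) =
  All.map⁺ (All.universal (λ _ ()) (elements p)) ∷ Unique.map⁺ Fin.suc-injective (elements-unique p)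
elements-unique {suc _} (false ∷ p) = Unique.map⁺ Fin.suc-injective (elements-unique p)

∣p∣≥1⇒nonempty : ∀ {n} (p : Subset n) → 1 ≤ ∣ p ∣ → Nonempty p
∣p∣≥1⇒nonempty {n} p 1≤∣p∣ with nonempty? p
... | yes p≢∅ = p≢∅
... | no p≡∅ = contradiction (trans (cong ∣_∣ (Empty-unique p≡∅)) (∣⊥∣≡0 n)) (>⇒≢ 1≤∣p∣)

∣p∪⁅x⁆∣≡1+∣p∣ : ∀ {n} (p : Subset n) {x : Fin n} → x ∉ₛ p → ∣ p ∪ ⁅ x ⁆ ∣ ≡ suc ∣ p ∣
∣p∪⁅x⁆∣≡1+∣p∣ {suc _} (true ∷ p) {zero} x∉p = contradiction here x∉p
∣p∪⁅x⁆∣≡1+∣p∣ {suc _} (false ∷ p) {zero} _ = cong suc (cong ∣_∣ (∪-identityʳ p))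
∣p∪⁅x⁆∣≡1+∣p∣ {suc _} (true ∷ p) {suc x} x∉p = cong suc (∣p∪⁅x⁆∣≡1+∣p∣ p (x∉p ∘ there))
∣p∪⁅x⁆∣≡1+∣p∣ {suc _} (false ∷ p) {suc x} x∉p = ∣p∪⁅x⁆∣≡1+∣p∣ p (x∉p ∘ there)

∪⁅⁆-injective : ∀ {n} (p : Subset n) {x y : Fin n} → x ∉ₛ p → p ∪ ⁅ x ⁆ ≡ p ∪ ⁅ y ⁆ → x ≡ y
∪⁅⁆-injective p {x} {y} x∉p eq with x∈p∪q⁻ p ⁅ y ⁆ (subst (x ∈ₛ_) eq (x∈p∪q⁺ (inj₂ (x∈⁅x⁆ x))))
... | inj₁ x∈p = contradiction x∈p x∉p
... | inj₂ x∈⁅y⁆ = x∈⁅y⁆⇒x≡y y x∈⁅y⁆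

Meets : ∀ {n} → Subset n → Subset n → Set
Meets s t = ∃[ i ] i ∈ₛ s × i ∈ₛ t

Meets⇒¬Disjoint : ∀ {n} {s t : Subset n} → Meets s t → ¬ Disjoint s t
Meets⇒¬Disjoint (_ , i∈s , i∈t) s∩t≡∅ = ∉⊥ (subst (_ ∈ₛ_) s∩t≡∅ (x∈p∩q⁺ (i∈s , i∈t)))

¬Disjoint⇒Meets : ∀ {n} (s t : Subset n) → ¬ Disjoint s t → Meets s t
¬Disjoint⇒Meets s t ¬disjoint with nonempty? (s ∩ t)
... | yes (i , i∈s∩t) = i , x∈p∩q⁻ s t i∈s∩t
... | no s∩t≡∅ = contradiction (Empty-unique s∩t≡∅) ¬disjoint

x∉p⇒Disjoint⁅x⁆ : ∀ {n} {p : Subset n} {x : Fin n} → x ∉ₛ p → Disjoint p ⁅ x ⁆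
x∉p⇒Disjoint⁅x⁆ {p = p} {x} x∉p = Empty-unique λ (i , i∈p∩⁅x⁆) →
  let (i∈p , i∈⁅x⁆) = x∈p∩q⁻ p ⁅ x ⁆ i∈p∩⁅x⁆ in x∉p (subst (_∈ₛ p) (x∈⁅y⁆⇒x≡y x i∈⁅x⁆) i∈p)

∈-disjoint-∉ : ∀ {n} {s t : Subset n} {i : Fin n} → Disjoint s t → i ∈ₛ s → i ∉ₛ t
∈-disjoint-∉ s∩t≡∅ i∈s i∈t = Meets⇒¬Disjoint (_ , i∈s , i∈t) s∩t≡∅

Meets-∪ʳ : ∀ {n} {s t : Subset n} (x : Fin n) → Meets s t → Meets s (t ∪ ⁅ x ⁆)
Meets-∪ʳ x (i , i∈s , i∈t) = i , i∈s , x∈p∪q⁺ (inj₁ i∈t)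

module Dominating {n r k : ℕ} {D : List (Subset n)}
  (dominating : IsKTupleDominating n r k D) (|D|≡k+r : length D ≡ k + r) where

  open DecMembership (_≟ˢ_ {n}) using () renaming (_∈?_ to _∈D?_)

  D-unique : Unique D
  D-unique = proj₁ (proj₁ dominating)

  ∣d∣≡r : ∀ {d} → d ∈ D → ∣ d ∣ ≡ r
  ∣d∣≡r = All.lookup (proj₂ (proj₁ dominating))

  record MeetingFamily (v : Subset n) : Set where
    field
      sets : List (Subset n)
      unique : Unique sets
      ⊆D : sets ⊆ D
      meet : ∀ {d} → d ∈ sets → Meets d v

  open MeetingFamily

  lift : ∀ {v} (x : Fin n) → MeetingFamily v → MeetingFamily (v ∪ ⁅ x ⁆)
  lift x F = record { sets = sets F ; unique = unique F ; ⊆D = ⊆D F ; meet = Meets-∪ʳ x ∘ meet F }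

  nonNeighbours≤r : ∀ {v} → ∣ v ∣ ≡ r → {L : List (Subset n)} → Unique L → L ⊆ D →
    (∀ {d} → d ∈ L → ¬ InClosedNbhd v d) → length L ≤ r
  nonNeighbours≤r {v} ∣v∣≡r {L} L-unique L⊆D L∩N[v]≡∅ = +-cancelˡ-≤ k _ _ (begin
    k + length L
      ≤⟨ +-mono-≤ (proj₂ dominating v ∣v∣≡r) (Unique-⊆⇒length≤ (_≟ˢ_ {n}) L-unique L⊆D∖N[v]) ⟩
    closedNbhdCount v D + length (filter (¬? ∘ inClosedNbhd? v) D)
      ≡⟨ length-filter+filter-∁ (inClosedNbhd? v) D ⟩
    length D
      ≡⟨ |D|≡k+r ⟩
    k + r ∎)
    where
    open ≤-Reasoning
    L⊆D∖N[v] : L ⊆ filter (¬? ∘ inClosedNbhd? v) D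
    L⊆D∖N[v] d∈L = ∈-filter⁺ _ (L⊆D d∈L) (L∩N[v]≡∅ d∈L)

  Meets⇒¬InClosedNbhd : ∀ {v d : Subset n} → ¬ d ≡ v → Meets d v → ¬ InClosedNbhd v d
  Meets⇒¬InClosedNbhd d≢v _ (inj₁ d≡v) = d≢v d≡v
  Meets⇒¬InClosedNbhd _ d∩v≢∅ (inj₂ disjoint) = Meets⇒¬Disjoint d∩v≢∅ disjoint

  meeting≤1+r : ∀ {v} → ∣ v ∣ ≡ r → (F : MeetingFamily v) → length (sets F) ≤ suc r
  meeting≤1+r {v} ∣v∣≡r F = begin
    length (sets F)  ≤⟨ Unique-⊆⇒length≤ (_≟ˢ_ {n}) (unique F) F⊆v∷others ⟩
    suc (length others)  ≤⟨ s≤s others≤r ⟩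
    suc r                ∎
    where
    open ≤-Reasoning
    ≢v? = λ d → ¬? (d ≟ˢ v)
    others = filter ≢v? (sets F)
    others≤r : length others ≤ r
    others≤r = nonNeighbours≤r ∣v∣≡r (Unique.filter⁺ ≢v? (unique F))
      (⊆D F ∘ proj₁ ∘ ∈-filter⁻ ≢v? {xs = sets F})
      (λ d∈ → let (d∈F , d≢v) = ∈-filter⁻ ≢v? {xs = sets F} d∈ in Meets⇒¬InClosedNbhd d≢v (meet F d∈F))
    F⊆v∷others : sets F ⊆ v ∷ others
    F⊆v∷others {d} d∈F with d ≟ˢ v
    ... | yes d≡v = here d≡v
    ... | no d≢v = there (∈-filter⁺ _ d∈F d≢v)

  meeting>r⇒∈D : ∀ {v} → ∣ v ∣ ≡ r → (F : MeetingFamily v) → r < length (sets F) → v ∈ D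
  meeting>r⇒∈D {v} ∣v∣≡r F r<|F| with v ∈D? D
  ... | yes v∈D = v∈D
  ... | no v∉D = contradiction
    (nonNeighbours≤r ∣v∣≡r (unique F) (⊆D F)
      (λ d∈F → Meets⇒¬InClosedNbhd (λ d≡v → v∉D (subst (_∈ D) d≡v (⊆D F d∈F))) (meet F d∈F)))
    (<⇒≱ r<|F|)

  SomeDisjoint : Subset n → Set
  SomeDisjoint T = ∃[ d ] d ∈ D × Disjoint d T

  AllMeet : Subset n → Set
  AllMeet T = ∀ {d} → d ∈ D → Meets d T

  disjointMember⊎allMeet : (T : Subset n) → SomeDisjoint T ⊎ AllMeet T
  disjointMember⊎allMeet T with any? (λ d → disjoint? d T) D
  ... | yes some = inj₁ (find some)
  ... | no none = inj₂ (λ {d} d∈D → ¬Disjoint⇒Meets d T (All.lookup (All.¬Any⇒All¬ D none) d∈D))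

  wholeFamily : ∀ {T} → AllMeet T → MeetingFamily T
  wholeFamily all-meet = record { sets = D ; unique = D-unique ; ⊆D = λ d∈D → d∈D ; meet = all-meet }

  add-disjoint : ∀ {d T e} → d ∈ D → Disjoint d T → e ∈ₛ d → MeetingFamily T → MeetingFamily (T ∪ ⁅ e ⁆)
  add-disjoint {d} {e = e} d∈D d∩T≡∅ e∈d H = record
    { sets = d ∷ sets H
    ; unique = All.tabulate (λ { h∈H refl → Meets⇒¬Disjoint (meet H h∈H) d∩T≡∅ }) ∷ unique H
    ; ⊆D = λ { (here refl) → d∈D ; (there h∈H) → ⊆D H h∈H }
    ; meet = λ { (here refl) → e , e∈d , x∈p∪q⁺ (inj₂ (x∈⁅x⁆ e)) ; (there h∈H) → Meets-∪ʳ e (meet H h∈H) } }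

  module Petals {T : Subset n} (1+∣T∣≡r : suc ∣ T ∣ ≡ r) {a : Fin n} (a∈T : a ∈ₛ T) where

    petals : List (Fin n) → List (Subset n)
    petals = map (λ e → T ∪ ⁅ e ⁆)

    ∣petal∣≡r : ∀ {e} → e ∉ₛ T → ∣ T ∪ ⁅ e ⁆ ∣ ≡ r
    ∣petal∣≡r e∉T = trans (∣p∪⁅x⁆∣≡1+∣p∣ T e∉T) 1+∣T∣≡r

    a∈petal : ∀ {d E} → d ∈ petals E → a ∈ₛ d
    a∈petal d∈ with ∈-map⁻ _ d∈
    ... | _ , _ , refl = x∈p∪q⁺ (inj₁ a∈T)

    petals-unique : ∀ {E} → Unique E → (∀ {e} → e ∈ E → e ∉ₛ T) → Unique (petals E)
    petals-unique E-unique E∩T≡∅ = Unique-map⁺ _ (λ e∈E _ → ∪⁅⁆-injective T (E∩T≡∅ e∈E)) E-unique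

    petals-overflow : ∀ {E} → Unique E → (∀ {e} → e ∈ E → e ∉ₛ T) → petals E ⊆ D →
      suc (suc r) ≤ length E → ⊥
    petals-overflow {e₀ ∷ E} E-unique E∩T≡∅ petals⊆D 2+r≤|E| = <⇒≱ 2+r≤|E| (begin
      length (e₀ ∷ E)           ≡⟨ sym (length-map _ (e₀ ∷ E)) ⟩
      length (petals (e₀ ∷ E))  ≤⟨ meeting≤1+r (∣petal∣≡r (E∩T≡∅ (here refl))) F ⟩
      suc r                     ∎)
      where
      open ≤-Reasoning
      F : MeetingFamily (T ∪ ⁅ e₀ ⁆)
      F = record
        { sets = petals (e₀ ∷ E) ; unique = petals-unique E-unique E∩T≡∅ ; ⊆D = petals⊆D
        ; meet = λ d∈ → a , a∈petal d∈ , x∈p∪q⁺ (inj₁ a∈T) }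

    petal∈D : (H : MeetingFamily T) → r ≤ length (sets H) →
      ∀ {d} → d ∈ D → Disjoint d T → ∀ {e} → e ∈ₛ d → T ∪ ⁅ e ⁆ ∈ D
    petal∈D H r≤|H| d∈D d∩T≡∅ e∈d =
      meeting>r⇒∈D (∣petal∣≡r (∈-disjoint-∉ d∩T≡∅ e∈d)) (add-disjoint d∈D d∩T≡∅ e∈d H) (s≤s r≤|H|)

    saturated : (H : MeetingFamily T) → suc r ≤ length (sets H) → suc (2 * r) ≤ n → ⊥
    saturated H 1+r≤|H| 2r+1≤n =
      petals-overflow (elements-unique (∁ T)) E∩T≡∅ petals⊆D (begin
        suc (suc r)  ≤⟨ 2+r≤n∸t 1+∣T∣≡r 2r+1≤n ⟩
        n ∸ ∣ T ∣    ≡⟨ sym (∣∁p∣≡n∸∣p∣ T) ⟩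
        ∣ ∁ T ∣       ≡⟨ sym (length-elements (∁ T)) ⟩
        length E     ∎)
      where
      open ≤-Reasoning
      E = elements (∁ T)
      E∩T≡∅ : ∀ {e} → e ∈ E → e ∉ₛ T
      E∩T≡∅ = x∈∁p⇒x∉p ∘ ∈-elements⁻ (∁ T)
      petals⊆D : petals E ⊆ D
      petals⊆D d∈ with ∈-map⁻ _ d∈
      ... | e , e∈E , refl = meeting>r⇒∈D (∣petal∣≡r (E∩T≡∅ e∈E)) (lift e H) 1+r≤|H|

    -- d, z and the r petals of d are r + 2 members of D meeting T ∪ {e₀}.
    blocked : (H : MeetingFamily T) → r ≤ length (sets H) →
      ∀ {d} → d ∈ D → Disjoint d T → ∀ {z} → z ∈ D → ¬ d ≡ z → a ∉ₛ z →
      ∀ {e₀} → e₀ ∈ₛ d → Meets z (T ∪ ⁅ e₀ ⁆) → ⊥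
    blocked H r≤|H| {d} d∈D d∩T≡∅ {z} z∈D d≢z a∉z {e₀} e₀∈d z-meets = <⇒≱ 2+r≤|L| (meeting≤1+r ∣petal∣≡r′ L)
      where
      open ≤-Reasoning
      E = elements d
      E∩T≡∅ : ∀ {e} → e ∈ E → e ∉ₛ T
      E∩T≡∅ = ∈-disjoint-∉ d∩T≡∅ ∘ ∈-elements⁻ d
      ∣petal∣≡r′ : ∣ T ∪ ⁅ e₀ ⁆ ∣ ≡ r
      ∣petal∣≡r′ = ∣petal∣≡r (∈-disjoint-∉ d∩T≡∅ e₀∈d)
      L : MeetingFamily (T ∪ ⁅ e₀ ⁆)
      L = record
        { sets = d ∷ z ∷ petals E
        ; unique = (d≢z ∷ All.tabulate (λ p d≡ → Meets⇒¬Disjoint (a , subst (a ∈ₛ_) (sym d≡) (a∈petal p) , a∈T) d∩T≡∅))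
                   ∷ All.tabulate (λ p z≡ → a∉z (subst (a ∈ₛ_) (sym z≡) (a∈petal p)))
                   ∷ petals-unique (elements-unique d) E∩T≡∅
        ; ⊆D = λ { (here refl) → d∈D ; (there (here refl)) → z∈D
                 ; (there (there p)) → let (e , e∈E , d≡) = ∈-map⁻ _ p in
                     subst (_∈ D) (sym d≡) (petal∈D H r≤|H| d∈D d∩T≡∅ (∈-elements⁻ d e∈E)) }
        ; meet = λ { (here refl) → e₀ , e₀∈d , x∈p∪q⁺ (inj₂ (x∈⁅x⁆ e₀)) ; (there (here refl)) → z-meets
                   ; (there (there p)) → a , a∈petal p , x∈p∪q⁺ (inj₁ a∈T) } }
      2+r≤|L| : suc (suc r) ≤ length (sets L)
      2+r≤|L| = s≤s (s≤s (≤-reflexive (sym (begin-equality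
        length (petals E)  ≡⟨ length-map _ E ⟩
        length E           ≡⟨ length-elements d ⟩
        ∣ d ∣               ≡⟨ ∣d∣≡r d∈D ⟩
        r                  ∎))))

  module IntersectingPair {x y : Subset n} (x∈D : x ∈ D) (y∈D : y ∈ D) (x≢y : ¬ x ≡ y)
    {a : Fin n} (a∈x : a ∈ₛ x) (a∈y : a ∈ₛ y) where

    pair : MeetingFamily ⁅ a ⁆
    pair = record
      { sets = x ∷ y ∷ [] ; unique = (x≢y ∷ []) ∷ [] ∷ []
      ; ⊆D = λ { (here refl) → x∈D ; (there (here refl)) → y∈D }
      ; meet = λ { (here refl) → a , a∈x , x∈⁅x⁆ a ; (there (here refl)) → a , a∈y , x∈⁅x⁆ a } }

    through-a : MeetingFamily ⁅ a ⁆
    through-a = record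
      { sets = filter (a ∈ₛ?_) D ; unique = Unique.filter⁺ _ D-unique ; ⊆D = proj₁ ∘ ∈-filter⁻ (a ∈ₛ?_) {xs = D}
      ; meet = λ d∈ → a , proj₂ (∈-filter⁻ (a ∈ₛ?_) {xs = D} d∈) , x∈⁅x⁆ a }

    avoiding-a : List (Subset n)
    avoiding-a = filter (¬? ∘ (a ∈ₛ?_)) D

    module Singleton (r≡2 : r ≡ 2) = Petals (trans (cong suc (∣⁅x⁆∣≡1 a)) (sym r≡2)) (x∈⁅x⁆ a)

    two-avoiders-impossible : r ≡ 2 → ∀ {d d′} → d ∈ D → d′ ∈ D → ¬ d ≡ d′ → a ∉ₛ d → a ∉ₛ d′ → ⊥
    two-avoiders-impossible refl {d} {d′} d∈D d′∈D d≢d′ a∉d a∉d′ with nonempty? (d ∩ d′)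
    ... | yes (e₀ , e₀∈d∩d′) = let (e₀∈d , e₀∈d′) = x∈p∩q⁻ d d′ e₀∈d∩d′ in
      Singleton.blocked refl pair ≤-refl d∈D (x∉p⇒Disjoint⁅x⁆ a∉d) d′∈D d≢d′ a∉d′ e₀∈d
        (e₀ , e₀∈d′ , x∈p∪q⁺ (inj₂ (x∈⁅x⁆ e₀)))
    ... | no d∩d′≡∅ = Singleton.petals-overflow refl
      (Unique.++⁺ (elements-unique d) (elements-unique d′)
        (λ (p , q) → d∩d′≡∅ (_ , x∈p∩q⁺ (∈-elements⁻ d p , ∈-elements⁻ d′ q))))
      E∩⁅a⁆≡∅ petals⊆D
      (≤-reflexive (sym (trans (length-++ (elements d))
        (cong₂ _+_ (trans (length-elements d) (∣d∣≡r d∈D)) (trans (length-elements d′) (∣d∣≡r d′∈D))))))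
      where
      E∩⁅a⁆≡∅ : ∀ {e} → e ∈ elements d ++ elements d′ → e ∉ₛ ⁅ a ⁆
      E∩⁅a⁆≡∅ e∈E e∈⁅a⁆ with ∈-++⁻ (elements d) e∈E | x∈⁅y⁆⇒x≡y a e∈⁅a⁆
      ... | inj₁ e∈d | refl = a∉d (∈-elements⁻ d e∈d)
      ... | inj₂ e∈d′ | refl = a∉d′ (∈-elements⁻ d′ e∈d′)
      petals⊆D : Singleton.petals refl (elements d ++ elements d′) ⊆ D
      petals⊆D p with ∈-map⁻ _ p
      ... | e , e∈E , refl with ∈-++⁻ (elements d) e∈E
      ...   | inj₁ e∈d = Singleton.petal∈D refl pair ≤-refl d∈D (x∉p⇒Disjoint⁅x⁆ a∉d) (∈-elements⁻ d e∈d)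
      ...   | inj₂ e∈d′ = Singleton.petal∈D refl pair ≤-refl d′∈D (x∉p⇒Disjoint⁅x⁆ a∉d′) (∈-elements⁻ d′ e∈d′)

    impossible-r≡2 : r ≡ 2 → 2 ≤ k → suc (2 * r) ≤ n → ⊥
    impossible-r≡2 refl 2≤k 2r+1≤n with 3 ≤? length (sets through-a)
    ... | yes 3≤|through-a| = Singleton.saturated refl through-a 3≤|through-a| 2r+1≤n
    ... | no |through-a|<3 =
      let (d , d′ , d∈ , d′∈ , d≢d′) = distinct-pair 2≤|avoiding-a| (Unique.filter⁺ _ D-unique)
          (d∈D , a∉d) = ∈-filter⁻ (¬? ∘ (a ∈ₛ?_)) {xs = D} d∈
          (d′∈D , a∉d′) = ∈-filter⁻ (¬? ∘ (a ∈ₛ?_)) {xs = D} d′∈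
      in two-avoiders-impossible refl d∈D d′∈D d≢d′ a∉d a∉d′
      where
      open ≤-Reasoning
      2≤|avoiding-a| : 2 ≤ length avoiding-a
      2≤|avoiding-a| = +-cancelˡ-≤ 2 _ _ (begin
        2 + 2                     ≤⟨ +-monoʳ-≤ 2 2≤k ⟩
        2 + k                     ≡⟨ +-comm 2 k ⟩
        k + 2                     ≡⟨ sym |D|≡k+r ⟩
        length D                  ≡⟨ sym (length-filter+filter-∁ (a ∈ₛ?_) D) ⟩
        length (sets through-a) + length avoiding-a  ≤⟨ +-monoˡ-≤ _ (≮⇒≥ |through-a|<3) ⟩
        2 + length avoiding-a     ∎)

    module Greedy (1≤r : 1 ≤ r) (1≤k : 1 ≤ k) where

      member-nonempty : ∀ {d} → d ∈ D → Nonempty d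
      member-nonempty {d} d∈D = ∣p∣≥1⇒nonempty d (≤-trans 1≤r (≤-reflexive (sym (∣d∣≡r d∈D))))

      1+r≤|D| : suc r ≤ length D
      1+r≤|D| = ≤-trans (+-monoˡ-≤ r 1≤k) (≤-reflexive (sym |D|≡k+r))

      -- In the second alternative H consists of x, y and t - 1 sets disjoint from an earlier T ∋ a.
      Progress : ℕ → List (Subset n) → Set
      Progress t H = suc r ≤ length H ⊎ (suc t ≤ length H × (2 ≤ t → ∃[ w ] w ∈ H × a ∉ₛ w))

      record Stage (t : ℕ) : Set where
        field
          T : Subset n
          ∣T∣≡t : ∣ T ∣ ≡ t
          a∈T : a ∈ₛ T
          H : MeetingFamily T
          progress : Progress t (sets H)

      start : Stage 1
      start = record
        { T = ⁅ a ⁆ ; ∣T∣≡t = ∣⁅x⁆∣≡1 a ; a∈T = x∈⁅x⁆ a ; H = pair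
        ; progress = inj₂ (≤-refl , λ { (s≤s ()) }) }

      extend : ∀ {t} → t < n → Stage t → Stage (suc t)
      extend {t} t<n S with disjointMember⊎allMeet (Stage.T S)
      ... | inj₁ (d , d∈D , d∩T≡∅) = record
        { T = T ∪ ⁅ e ⁆ ; ∣T∣≡t = trans (∣p∪⁅x⁆∣≡1+∣p∣ T e∉T) (cong suc ∣T∣≡t) ; a∈T = x∈p∪q⁺ (inj₁ a∈T)
        ; H = add-disjoint d∈D d∩T≡∅ e∈d H ; progress = progress′ progress }
        where
        open Stage S
        e = proj₁ (member-nonempty d∈D)
        e∈d = proj₂ (member-nonempty d∈D)
        e∉T = ∈-disjoint-∉ d∩T≡∅ e∈d
        progress′ : Progress t (sets H) → Progress (suc t) (d ∷ sets H)
        progress′ (inj₁ 1+r≤|H|) = inj₁ (m≤n⇒m≤1+n 1+r≤|H|)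
        progress′ (inj₂ (1+t≤|H| , _)) = inj₂ (s≤s 1+t≤|H| , λ _ → d , here refl , λ a∈d → ∈-disjoint-∉ d∩T≡∅ a∈d a∈T)
      ... | inj₂ all-meet = record
        { T = T ∪ ⁅ e ⁆ ; ∣T∣≡t = trans (∣p∪⁅x⁆∣≡1+∣p∣ T e∉T) (cong suc ∣T∣≡t) ; a∈T = x∈p∪q⁺ (inj₁ a∈T)
        ; H = lift e (wholeFamily all-meet) ; progress = inj₁ 1+r≤|D| }
        where
        open Stage S
        e∈∁T = ∣p∣≥1⇒nonempty (∁ T) (begin
          1            ≤⟨ m<n⇒0<n∸m (subst (_< n) (sym ∣T∣≡t) t<n) ⟩
          n ∸ ∣ T ∣     ≡⟨ sym (∣∁p∣≡n∸∣p∣ T) ⟩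
          ∣ ∁ T ∣       ∎)
          where open ≤-Reasoning
        e = proj₁ e∈∁T
        e∉T : e ∉ₛ T
        e∉T = x∈∁p⇒x∉p (proj₂ e∈∁T)

      stage : ∀ j → j < n → Stage (suc j)
      stage zero _ = start
      stage (suc j) 1+j<n = extend 1+j<n (stage j (<-trans (n<1+n j) 1+j<n))

      conclude : ∀ {q} → r ≡ 3 + q → suc (2 * r) ≤ n → Stage (2 + q) → ⊥
      conclude refl 2r+1≤n S = finish progress (disjointMember⊎allMeet T)
        where
        open Stage S
        open Petals (cong suc ∣T∣≡t) a∈T
        finish : Progress _ (sets H) → SomeDisjoint T ⊎ AllMeet T → ⊥
        finish (inj₁ 1+r≤|H|) _ = saturated H 1+r≤|H| 2r+1≤n
        finish (inj₂ _) (inj₂ all-meet) = saturated (wholeFamily all-meet) 1+r≤|D| 2r+1≤n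
        finish (inj₂ (r≤|H| , avoider)) (inj₁ (d , d∈D , d∩T≡∅)) with avoider (s≤s (s≤s z≤n))
        ... | w , w∈H , a∉w =
          blocked H r≤|H| d∈D d∩T≡∅ (⊆D H w∈H) d≢w a∉w e₀∈d (Meets-∪ʳ _ (meet H w∈H))
          where
          d≢w : ¬ d ≡ w
          d≢w refl = Meets⇒¬Disjoint (meet H w∈H) d∩T≡∅
          e₀∈d = proj₂ (member-nonempty d∈D)

    impossible-r≥3 : ∀ {q} → r ≡ 3 + q → 1 ≤ k → suc (2 * r) ≤ n → ⊥
    impossible-r≥3 {q} refl 1≤k 2r+1≤n =
      conclude refl 2r+1≤n (stage (suc q) (≤-trans (n≤1+n _) (≤-trans (m≤m+n _ _) (≤-trans (n≤1+n _) 2r+1≤n))))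
      where open Greedy (s≤s z≤n) 1≤k

  no-intersecting-pair : 2 ≤ r → suc (2 * r) ≤ n → 1 ≤ k → (r ≡ 2 → 2 ≤ k) →
    ∀ {x y} → x ∈ D → y ∈ D → ¬ x ≡ y → ¬ Meets x y
  no-intersecting-pair 2≤r 2r+1≤n 1≤k r≡2⇒2≤k x∈D y∈D x≢y (a , a∈x , a∈y) =
    [ (λ r≡2 → impossible-r≡2 r≡2 (r≡2⇒2≤k r≡2) 2r+1≤n) , (λ (_ , r≡3+q) → impossible-r≥3 r≡3+q 1≤k 2r+1≤n) ]
      (2≤m⇒≡2⊎≡3+ 2≤r)
    where open IntersectingPair x∈D y∈D x≢y a∈x a∈y

lemma10 : (n r k : ℕ) → 2 ≤ r → suc (2 * r) ≤ n → 1 ≤ k → (r ≡ 2 → 2 ≤ k) →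
    (D : List (Subset n)) → IsKTupleDominating n r k D → length D ≡ k + r →
    PairwiseDisjoint D
lemma10 n r k 2≤r 2r+1≤n 1≤k r≡2⇒2≤k D dominating |D|≡k+r x y x∈D y∈D x≢y =
  decidable-stable (disjoint? x y)
    (no-intersecting-pair 2≤r 2r+1≤n 1≤k r≡2⇒2≤k x∈D y∈D x≢y ∘ ¬Disjoint⇒Meets x y)
  where open Dominating dominating |D|≡k+r
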